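{- Let $G=(V,E)$ be a simple undirected graph on $n$ vertices. Then $G$ has an automorphism that is an involution without fixed points if and only if $G$ admits an equitable partition with $\frac{n}{2}$ cells, each of size $2$.
   Context: An automorphism of $G$ is a bijection $\gamma:V\to V$ with $\{\gamma(u),\gamma(v)\}\in E$ iff $\{u,v\}\in E$; it is an involution if $\gamma^2$ is the identity and $\gamma$ is not; it is fixed-point-free if $\gamma(v)\neq v$ for all $v$. A partition $\{V_1,\dots,V_m\}$ of $V$ is equitable if for all $i,j$ the number of neighbors in $V_j$ of a vertex $u\in V_i$ does not depend on the choice of $u\in V_i$. -}

module Defs where

open import Data.Nat using (ℕ; zero; suc; _+_; _/_; _≥_)
open import Data.Bool using (Bool; true; false; _∧_)
open import Data.Fin using (Fin; zero; suc; _≟_)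
open import Data.Product using (Σ; _×_; _,_; ∃)
open import Relation.Nullary using (¬_; does)
open import Relation.Binary.PropositionalEquality using (_≡_)
open import Function.Bundles using (Inverse)
open import Data.Fin.Permutation using (Permutation)

b2n : Bool → ℕ
b2n true  = 1
b2n false = 0

count : {n : ℕ} → (Fin n → Bool) → ℕ
count {zero}  p = 0
count {suc n} p = b2n (p zero) + count (λ i → p (suc i))

record Graph (n : ℕ) : Set where
  field
    adj       : Fin n → Fin n → Bool
    symmetric : ∀ u v → adj u v ≡ adj v u
    loopless  : ∀ v → adj v v ≡ false
open Graph public

IsAutomorphism : {n : ℕ} → Graph n → Permutation n n → Set
IsAutomorphism G γ = ∀ u v → adj G (Inverse.to γ u) (Inverse.to γ v) ≡ adj G u v

IsInvolution : {n : ℕ} → Permutation n n → Set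
IsInvolution γ = (∀ v → Inverse.to γ (Inverse.to γ v) ≡ v)
               × ¬ (∀ v → Inverse.to γ v ≡ v)

FixedPointFree : {n : ℕ} → Permutation n n → Set
FixedPointFree γ = ∀ v → ¬ (Inverse.to γ v ≡ v)

-- A partition of Fin n into m cells, given by the cell-labelling c : Fin n → Fin m
-- (cell i is { v | c v ≡ i }).  Number of neighbours of u in cell j:
degIn : {n m : ℕ} → Graph n → (Fin n → Fin m) → Fin n → Fin m → ℕ
degIn G c u j = count (λ w → adj G u w ∧ does (c w ≟ j))

cellSize : {n m : ℕ} → (Fin n → Fin m) → Fin m → ℕ
cellSize c i = count (λ w → does (c w ≟ i))

IsEquitable : {n m : ℕ} → Graph n → (Fin n → Fin m) → Set
IsEquitable G c = ∀ i j u u' → c u ≡ i → c u' ≡ i → degIn G c u j ≡ degIn G c u' j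

-- every cell has exactly two elements (in particular all cells are nonempty,
-- so c really describes a partition with exactly m cells)
AllCellsPairs : {n m : ℕ} → (Fin n → Fin m) → Set
AllCellsPairs c = ∀ i → cellSize c i ≡ 2

HasEquitablePairPartition : {n : ℕ} → Graph n → Set
HasEquitablePairPartition {n} G =
  Σ (Fin n → Fin (n / 2)) λ c → AllCellsPairs c × IsEquitable G c

{-# OPTIONS --safe #-}
module Submission where

-- A fixed-point-free involution γ splits the vertices into its n/2 orbits {v, γ v};
-- conversely a partition into pairs determines the involution γ swapping the two
-- elements of each cell.  When the cells of c are the orbits of γ, the number of
-- neighbours of x in the cell of v is [x ~ v] + [x ~ γ v].  If γ is an automorphism,
-- this count is invariant under x ↦ γ x, which is equitability since the cell of x
-- is {x, γ x}.  Conversely, equitability applied to u, γ u in the cell of v and to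
-- v, γ v in the cell of u gives a + b = c + d and a + c = b + d for a = [u ~ v],
-- b = [u ~ γ v], c = [γ u ~ v], d = [γ u ~ γ v], whence a = d.

open import Defs
open import Data.Nat using (ℕ; zero; suc; _+_; _*_; _/_; _≥_; ⌊_/2⌋)
open import Data.Nat.Properties
  using (+-identityʳ; +-suc; +-comm; *-comm; suc-injective; +-cancelʳ-≡; n≡⌊n+n/2⌋;
         +-0-commutativeMonoid; +-commutativeSemigroup)
open import Data.Nat.DivMod using (m*n/n≡m)
open import Algebra.Properties.CommutativeSemigroup +-commutativeSemigroup
  using (x∙yz≈y∙xz; interchange)
open import Algebra.Properties.CommutativeMonoid.Sum +-0-commutativeMonoid
  using (sum; sum-permute)
open import Data.Bool using (Bool; true; false; T; not; _∧_; if_then_else_)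
open import Data.Bool.Properties using (∧-zeroʳ; ∧-identityʳ; T-∧; T-irrelevant)
open import Data.Fin using (Fin; zero; suc; _≟_; _↑ˡ_; _↑ʳ_; splitAt; fromℕ<)
open import Data.Fin.Properties
  using (_<?_; <-cmp; <-asym; ↑ʳ-injective; splitAt-↑ˡ; splitAt-↑ʳ; splitAt⁻¹-↑ˡ; splitAt⁻¹-↑ʳ)
open import Data.Fin.Permutation using (Permutation; permutation)
open import Data.Product using (Σ; _×_; _,_; proj₁; proj₂; ∃)
open import Data.Sum using (_⊎_; inj₁; inj₂)
open import Data.Empty using (⊥; ⊥-elim)
open import Function using (_∘_)
open import Function.Bundles using (_⇔_; mk⇔; Inverse; Equivalence)
open import Relation.Binary.Definitions using (tri<; tri≈; tri>)
open import Relation.Nullary using (¬_; Dec; does; yes; no)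
open import Relation.Nullary.Decidable using (dec-true; dec-false)
open import Relation.Binary.PropositionalEquality
open ≡-Reasoning

b2n-injective : ∀ {a b} → b2n a ≡ b2n b → a ≡ b
b2n-injective {false} {false} _ = refl
b2n-injective {true}  {true}  _ = refl

∧-does-true : ∀ {A : Set} (b : Bool) (a? : Dec A) → A → b ∧ does a? ≡ b
∧-does-true b a? a = trans (cong (b ∧_) (dec-true a? a)) (∧-identityʳ b)

T-does⇒ : ∀ {A : Set} (a? : Dec A) → T (does a?) → A
T-does⇒ (yes a) _ = a

T-not-does⇒¬ : ∀ {A : Set} (a? : Dec A) → T (not (does a?)) → ¬ A
T-not-does⇒¬ (no ¬a) _ = ¬a

count-ext : ∀ {n} {p q : Fin n → Bool} → (∀ w → p w ≡ q w) → count p ≡ count q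
count-ext {zero}  e = refl
count-ext {suc n} e = cong₂ _+_ (cong b2n (e zero)) (count-ext (e ∘ suc))

count≡sum : ∀ {n} (p : Fin n → Bool) → count p ≡ sum (b2n ∘ p)
count≡sum {zero}  p = refl
count≡sum {suc n} p = cong (b2n (p zero) +_) (count≡sum (p ∘ suc))

count-permute : ∀ {n} (p : Fin n → Bool) (π : Permutation n n) →
                count (p ∘ Inverse.to π) ≡ count p
count-permute p π = begin
  count (p ∘ Inverse.to π)     ≡⟨ count≡sum (p ∘ Inverse.to π) ⟩
  sum (b2n ∘ p ∘ Inverse.to π) ≡⟨ sum-permute (b2n ∘ p) π ⟨
  sum (b2n ∘ p)                ≡⟨ count≡sum p ⟨
  count p                      ∎

count-complement : ∀ {n} (p : Fin n → Bool) → count p + count (not ∘ p) ≡ n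
count-complement {zero}  p = refl
count-complement {suc n} p with p zero
... | true  = cong suc (count-complement (p ∘ suc))
... | false = trans (+-suc _ _) (cong suc (count-complement (p ∘ suc)))

count-none : ∀ {n} {p : Fin n → Bool} → (∀ w → ¬ T (p w)) → count p ≡ 0
count-none {zero}      none = refl
count-none {suc n} {p} none with p zero | none zero
... | false | _     = count-none (none ∘ suc)
... | true  | ¬true = ⊥-elim (¬true _)

delete : ∀ {n} → Fin n → (Fin n → Bool) → Fin n → Bool
delete u p w = p w ∧ not (does (u ≟ w))

count-delete : ∀ {n} (p : Fin n → Bool) (u : Fin n) →
               count p ≡ b2n (p u) + count (delete u p)
count-delete {suc n} p zero =
  cong (b2n (p zero) +_)
    (sym (cong₂ _+_ (cong b2n (∧-zeroʳ (p zero))) (count-ext (λ w → ∧-identityʳ (p (suc w))))))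
count-delete {suc n} p (suc u) = begin
  b2n (p zero) + count (p ∘ suc)
    ≡⟨ cong (b2n (p zero) +_) (count-delete (p ∘ suc) u) ⟩
  b2n (p zero) + (b2n (p (suc u)) + count (delete u (p ∘ suc)))
    ≡⟨ x∙yz≈y∙xz (b2n (p zero)) (b2n (p (suc u))) (count (delete u (p ∘ suc))) ⟩
  b2n (p (suc u)) + (b2n (p zero) + count (delete u (p ∘ suc)))
    ≡⟨ cong (λ b → b2n (p (suc u)) + (b2n b + count (delete u (p ∘ suc))))
            (∧-identityʳ (p zero)) ⟨
  b2n (p (suc u)) + count (delete (suc u) p) ∎

count-pair : ∀ {n} (p : Fin n → Bool) {u v : Fin n} → u ≢ v →
             (∀ w → T (p w) → w ≡ u ⊎ w ≡ v) → count p ≡ b2n (p u) + b2n (p v)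
count-pair p {u} {v} u≢v only = begin
  count p
    ≡⟨ count-delete p u ⟩
  b2n (p u) + count (delete u p)
    ≡⟨ cong (b2n (p u) +_) (count-delete (delete u p) v) ⟩
  b2n (p u) + (b2n (delete u p v) + count (delete v (delete u p)))
    ≡⟨ cong₂ (λ a k → b2n (p u) + (b2n a + k)) delete-u-at-v nothing-left ⟩
  b2n (p u) + (b2n (p v) + 0)
    ≡⟨ cong (b2n (p u) +_) (+-identityʳ (b2n (p v))) ⟩
  b2n (p u) + b2n (p v) ∎
  where
  delete-u-at-v : delete u p v ≡ p v
  delete-u-at-v = trans (cong (λ b → p v ∧ not b) (dec-false (u ≟ v) u≢v)) (∧-identityʳ (p v))
  neither : ∀ {w} → w ≡ u ⊎ w ≡ v → u ≢ w → v ≢ w → ⊥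
  neither (inj₁ refl) u≢w _   = u≢w refl
  neither (inj₂ refl) _   v≢w = v≢w refl
  nothing-left : count (delete v (delete u p)) ≡ 0
  nothing-left = count-none λ w h →
    let (h′ , v≢w) = Equivalence.to T-∧ h
        (pw , u≢w) = Equivalence.to T-∧ h′
    in neither (only w pw) (T-not-does⇒¬ (u ≟ w) u≢w) (T-not-does⇒¬ (v ≟ w) v≢w)

T⇒Fin : ∀ {b} → T b → Fin (b2n b)
T⇒Fin {true} _ = zero

Fin⇒T : ∀ {b} → Fin (b2n b) → T b
Fin⇒T {true} _ = _

T⇒Fin∘Fin⇒T : ∀ {b} (i : Fin (b2n b)) → T⇒Fin (Fin⇒T i) ≡ i
T⇒Fin∘Fin⇒T {true} zero = refl

↑ˡ≢↑ʳ : ∀ {m n} (i : Fin m) (j : Fin n) → i ↑ˡ n ≢ m ↑ʳ j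
↑ˡ≢↑ʳ {m} {n} i j e
  with () ← trans (sym (splitAt-↑ˡ m i n)) (trans (cong (splitAt m) e) (splitAt-↑ʳ m n j))

index : ∀ {n} (p : Fin n → Bool) (v : Fin n) → T (p v) → Fin (count p)
index p zero    h = T⇒Fin h ↑ˡ count (p ∘ suc)
index p (suc v) h = b2n (p zero) ↑ʳ index (p ∘ suc) v h

index-cong : ∀ {n} (p : Fin n → Bool) {v w : Fin n} (h : T (p v)) (h′ : T (p w)) →
             v ≡ w → index p v h ≡ index p w h′
index-cong p h h′ refl = cong (index p _) (T-irrelevant h h′)

index-injective : ∀ {n} (p : Fin n → Bool) {v w : Fin n} (h : T (p v)) (h′ : T (p w)) →
                  index p v h ≡ index p w h′ → v ≡ w
index-injective p {zero}  {zero}  h h′ e = refl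
index-injective p {zero}  {suc w} h h′ e = ⊥-elim (↑ˡ≢↑ʳ _ _ e)
index-injective p {suc v} {zero}  h h′ e = ⊥-elim (↑ˡ≢↑ʳ _ _ (sym e))
index-injective p {suc v} {suc w} h h′ e =
  cong suc (index-injective (p ∘ suc) h h′ (↑ʳ-injective (b2n (p zero)) _ _ e))

index-surjective : ∀ {n} (p : Fin n → Bool) (i : Fin (count p)) →
                   Σ (Fin n) λ v → Σ (T (p v)) λ h → index p v h ≡ i
index-surjective {suc n} p i with splitAt (b2n (p zero)) i in e
... | inj₁ x =
  zero , Fin⇒T x , trans (cong (_↑ˡ count (p ∘ suc)) (T⇒Fin∘Fin⇒T x)) (splitAt⁻¹-↑ˡ e)
... | inj₂ j with index-surjective (p ∘ suc) j
...   | v , h , e′ = suc v , h , trans (cong (b2n (p zero) ↑ʳ_) e′) (splitAt⁻¹-↑ʳ e)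

count≡1⇒unique : ∀ {n} (p : Fin n → Bool) → count p ≡ 1 →
                 Σ (Fin n) λ v → T (p v) × (∀ w → T (p w) → w ≡ v)
count≡1⇒unique p e with index-surjective p (subst Fin (sym e) zero)
... | v , h , _ = v , h , λ w h′ → index-injective p h′ h (Fin-one e _ _)
  where
  Fin-one : ∀ {k} → k ≡ 1 → (i j : Fin k) → i ≡ j
  Fin-one refl zero zero = refl

m+m≡n⇒m≡n/2 : ∀ {m n} → m + m ≡ n → m ≡ n / 2
m+m≡n⇒m≡n/2 {m} refl = sym (begin
  (m + m) / 2       ≡⟨ cong (λ k → (m + k) / 2) (+-identityʳ m) ⟨
  (2 * m) / 2       ≡⟨ cong (_/ 2) (*-comm 2 m) ⟩
  (m * 2) / 2       ≡⟨ m*n/n≡m m 2 ⟩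
  m                 ∎)

x+y≡z+w⇒x+z≡y+w⇒x≡w : ∀ x y z w → x + y ≡ z + w → x + z ≡ y + w → x ≡ w
x+y≡z+w⇒x+z≡y+w⇒x≡w x y z w e₁ e₂ = begin
  x                 ≡⟨ n≡⌊n+n/2⌋ x ⟩
  ⌊ x + x /2⌋       ≡⟨ cong ⌊_/2⌋ (+-cancelʳ-≡ (y + z) (x + x) (w + w) doubled) ⟩
  ⌊ w + w /2⌋       ≡⟨ n≡⌊n+n/2⌋ w ⟨
  w                 ∎
  where
  doubled : (x + x) + (y + z) ≡ (w + w) + (y + z)
  doubled = begin
    (x + x) + (y + z) ≡⟨ interchange x y x z ⟨
    (x + y) + (x + z) ≡⟨ cong₂ _+_ e₁ e₂ ⟩
    (z + w) + (y + w) ≡⟨ interchange z w y w ⟩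
    (z + y) + (w + w) ≡⟨ +-comm (z + y) (w + w) ⟩
    (w + w) + (z + y) ≡⟨ cong ((w + w) +_) (+-comm z y) ⟩
    (w + w) + (y + z) ∎

CellsAreOrbits : ∀ {n m} → (Fin n → Fin n) → (Fin n → Fin m) → Set
CellsAreOrbits γ c = ∀ v w → c w ≡ c v ⇔ (w ≡ v ⊎ w ≡ γ v)

module OrbitCells {n m} (γ : Fin n → Fin n) (c : Fin n → Fin m)
                  (orbits : CellsAreOrbits γ c) (moved : ∀ v → γ v ≢ v) where

  γ-cell : ∀ v → c (γ v) ≡ c v
  γ-cell v = Equivalence.from (orbits v (γ v)) (inj₂ refl)

  γ-involutive : ∀ v → γ (γ v) ≡ v
  γ-involutive v with Equivalence.to (orbits v (γ (γ v))) (trans (γ-cell (γ v)) (γ-cell v))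
  ... | inj₁ e = e
  ... | inj₂ e = ⊥-elim (moved (γ v) e)

  γ-perm : Permutation n n
  γ-perm = permutation γ γ γ-involutive γ-involutive

  count-cell : (p : Fin n → Bool) (v : Fin n) → (∀ w → T (p w) → c w ≡ c v) →
               count p ≡ b2n (p v) + b2n (p (γ v))
  count-cell p v in-cell =
    count-pair p (moved v ∘ sym) (λ w h → Equivalence.to (orbits v w) (in-cell w h))

  cellSize-orbit : ∀ v → cellSize c (c v) ≡ 2
  cellSize-orbit v = begin
    cellSize c (c v)
      ≡⟨ count-cell _ v (λ w → T-does⇒ (c w ≟ c v)) ⟩
    b2n (does (c v ≟ c v)) + b2n (does (c (γ v) ≟ c v))
      ≡⟨ cong₂ (λ a b → b2n a + b2n b) (dec-true (c v ≟ c v) refl) (dec-true (c (γ v) ≟ c v) (γ-cell v)) ⟩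
    2 ∎

  degIn-orbit : (G : Graph n) (x v : Fin n) →
                degIn G c x (c v) ≡ b2n (adj G x v) + b2n (adj G x (γ v))
  degIn-orbit G x v = begin
    degIn G c x (c v)
      ≡⟨ count-cell _ v (λ w h → T-does⇒ (c w ≟ c v) (proj₂ (Equivalence.to T-∧ h))) ⟩
    b2n (adj G x v ∧ does (c v ≟ c v)) + b2n (adj G x (γ v) ∧ does (c (γ v) ≟ c v))
      ≡⟨ cong₂ (λ a b → b2n a + b2n b) (∧-does-true (adj G x v) (c v ≟ c v) refl)
                                       (∧-does-true (adj G x (γ v)) (c (γ v) ≟ c v) (γ-cell v)) ⟩
    b2n (adj G x v) + b2n (adj G x (γ v)) ∎

  degIn-γ : (G : Graph n) → IsAutomorphism G γ-perm →
            ∀ x j → degIn G c (γ x) j ≡ degIn G c x j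
  degIn-γ G aut x j = begin
    count (λ w → adj G (γ x) w ∧ does (c w ≟ j))
      ≡⟨ count-permute _ γ-perm ⟨
    count (λ w → adj G (γ x) (γ w) ∧ does (c (γ w) ≟ j))
      ≡⟨ count-ext (λ w → cong₂ (λ a d → a ∧ does (d ≟ j)) (aut x w) (γ-cell w)) ⟩
    count (λ w → adj G x w ∧ does (c w ≟ j)) ∎

  automorphism⇒equitable : (G : Graph n) → IsAutomorphism G γ-perm → IsEquitable G c
  automorphism⇒equitable G aut i j u u′ cu cu′
    with Equivalence.to (orbits u u′) (trans cu′ (sym cu))
  ... | inj₁ refl = refl
  ... | inj₂ refl = sym (degIn-γ G aut u j)

  equitable⇒automorphism : (G : Graph n) → IsEquitable G c → IsAutomorphism G γ-perm
  equitable⇒automorphism G equitable u v =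
    sym (b2n-injective (x+y≡z+w⇒x+z≡y+w⇒x≡w _ _ _ _ same-cell-of-v same-cell-of-u))
    where
    [_~_] : Fin n → Fin n → ℕ
    [ x ~ y ] = b2n (adj G x y)
    same-cell-of-v : [ u ~ v ] + [ u ~ γ v ] ≡ [ γ u ~ v ] + [ γ u ~ γ v ]
    same-cell-of-v = begin
      [ u ~ v ] + [ u ~ γ v ]     ≡⟨ degIn-orbit G u v ⟨
      degIn G c u (c v)           ≡⟨ equitable (c u) (c v) u (γ u) refl (γ-cell u) ⟩
      degIn G c (γ u) (c v)       ≡⟨ degIn-orbit G (γ u) v ⟩
      [ γ u ~ v ] + [ γ u ~ γ v ] ∎
    same-cell-of-u : [ u ~ v ] + [ γ u ~ v ] ≡ [ u ~ γ v ] + [ γ u ~ γ v ]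
    same-cell-of-u = begin
      [ u ~ v ] + [ γ u ~ v ]     ≡⟨ cong₂ (λ a b → b2n a + b2n b) (symmetric G u v) (symmetric G (γ u) v) ⟩
      [ v ~ u ] + [ v ~ γ u ]     ≡⟨ degIn-orbit G v u ⟨
      degIn G c v (c u)           ≡⟨ equitable (c v) (c u) v (γ v) refl (γ-cell v) ⟩
      degIn G c (γ v) (c u)       ≡⟨ degIn-orbit G (γ v) u ⟩
      [ γ v ~ u ] + [ γ v ~ γ u ] ≡⟨ cong₂ (λ a b → b2n a + b2n b) (symmetric G (γ v) u) (symmetric G (γ v) (γ u)) ⟩
      [ u ~ γ v ] + [ γ u ~ γ v ] ∎

module Partner {n m} (c : Fin n → Fin m) (pairs : AllCellsPairs c) where

  cellmates : Fin n → Fin n → Bool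
  cellmates u = delete u (λ w → does (c w ≟ c u))

  cellmate⇔ : ∀ u w → T (cellmates u w) ⇔ (c w ≡ c u × u ≢ w)
  cellmate⇔ u w = mk⇔
    (λ h → let (same , distinct) = Equivalence.to T-∧ h
           in T-does⇒ (c w ≟ c u) same , T-not-does⇒¬ (u ≟ w) distinct)
    (λ (same , distinct) → Equivalence.from T-∧
      ( subst T (sym (dec-true (c w ≟ c u) same)) _
      , subst (T ∘ not) (sym (dec-false (u ≟ w) distinct)) _))

  count-cellmates : ∀ u → count (cellmates u) ≡ 1
  count-cellmates u = suc-injective (begin
    1 + count (cellmates u)
      ≡⟨ cong (λ b → b2n b + count (cellmates u)) (dec-true (c u ≟ c u) refl) ⟨
    b2n (does (c u ≟ c u)) + count (cellmates u)
      ≡⟨ count-delete _ u ⟨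
    cellSize c (c u)
      ≡⟨ pairs (c u) ⟩
    2 ∎)

  unique-cellmate : ∀ u → Σ (Fin n) λ v →
                    T (cellmates u v) × (∀ w → T (cellmates u w) → w ≡ v)
  unique-cellmate u = count≡1⇒unique (cellmates u) (count-cellmates u)

  partner : Fin n → Fin n
  partner u = proj₁ (unique-cellmate u)

  partner-cellmate : ∀ u → c (partner u) ≡ c u × u ≢ partner u
  partner-cellmate u =
    Equivalence.to (cellmate⇔ u (partner u)) (proj₁ (proj₂ (unique-cellmate u)))

  partner-unique : ∀ u w → c w ≡ c u → u ≢ w → w ≡ partner u
  partner-unique u w same distinct =
    proj₂ (proj₂ (unique-cellmate u)) w (Equivalence.from (cellmate⇔ u w) (same , distinct))

  partner-moved : ∀ u → partner u ≢ u
  partner-moved u e = proj₂ (partner-cellmate u) (sym e)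

  partner-orbits : CellsAreOrbits partner c
  partner-orbits u w = mk⇔ to from
    where
    to : c w ≡ c u → w ≡ u ⊎ w ≡ partner u
    to same with u ≟ w
    ... | yes refl    = inj₁ refl
    ... | no distinct = inj₂ (partner-unique u w same distinct)
    from : w ≡ u ⊎ w ≡ partner u → c w ≡ c u
    from (inj₁ refl) = refl
    from (inj₂ refl) = proj₁ (partner-cellmate u)

does-<-swap : ∀ {n} {a b : Fin n} → a ≢ b → does (b <? a) ≡ not (does (a <? b))
does-<-swap {a = a} {b} a≢b with <-cmp a b
... | tri< a<b _ _ rewrite dec-true (a <? b) a<b | dec-false (b <? a) (<-asym a<b) = refl
... | tri≈ _ a≡b _ = ⊥-elim (a≢b a≡b)
... | tri> _ _ b<a rewrite dec-false (a <? b) (<-asym b<a) | dec-true (b <? a) b<a = refl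

module Representatives {n} (γ : Fin n → Fin n) (involutive : ∀ v → γ (γ v) ≡ v)
                       (moved : ∀ v → γ v ≢ v) where

  isRep : Fin n → Bool
  isRep v = does (v <? γ v)

  isRep-γ : ∀ v → isRep (γ v) ≡ not (isRep v)
  isRep-γ v rewrite involutive v = does-<-swap (moved v ∘ sym)

  rep : Fin n → Fin n
  rep v = if isRep v then v else γ v

  rep-isRep : ∀ v → T (isRep (rep v))
  rep-isRep v with isRep v in e
  ... | true  = subst T (sym e) _
  ... | false = subst T (sym (trans (isRep-γ v) (cong not e))) _

  rep-of-rep : ∀ v → T (isRep v) → rep v ≡ v
  rep-of-rep v h with isRep v
  ... | true = refl

  rep-γ : ∀ v → rep (γ v) ≡ rep v
  rep-γ v rewrite isRep-γ v with isRep v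
  ... | true  = involutive v
  ... | false = refl

  rep-orbit : ∀ v → rep v ≡ v ⊎ rep v ≡ γ v
  rep-orbit v with isRep v
  ... | true  = inj₁ refl
  ... | false = inj₂ refl

  γ-injective : ∀ {v w} → γ v ≡ γ w → v ≡ w
  γ-injective {v} {w} e = trans (sym (involutive v)) (trans (cong γ e) (involutive w))

  same-rep⇔ : ∀ v w → rep w ≡ rep v ⇔ (w ≡ v ⊎ w ≡ γ v)
  same-rep⇔ v w = mk⇔ (to (rep-orbit w) (rep-orbit v)) from
    where
    to : rep w ≡ w ⊎ rep w ≡ γ w → rep v ≡ v ⊎ rep v ≡ γ v → rep w ≡ rep v → w ≡ v ⊎ w ≡ γ v
    to (inj₁ rw) (inj₁ rv) e = inj₁ (trans (sym rw) (trans e rv))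
    to (inj₁ rw) (inj₂ rv) e = inj₂ (trans (sym rw) (trans e rv))
    to (inj₂ rw) (inj₁ rv) e =
      inj₂ (trans (sym (involutive w)) (cong γ (trans (sym rw) (trans e rv))))
    to (inj₂ rw) (inj₂ rv) e = inj₁ (γ-injective (trans (sym rw) (trans e rv)))
    from : w ≡ v ⊎ w ≡ γ v → rep w ≡ rep v
    from (inj₁ refl) = refl
    from (inj₂ refl) = rep-γ v

  -- An orbit is labelled by the rank of its smaller element among all orbit minima.
  label : Fin n → Fin (count isRep)
  label v = index isRep (rep v) (rep-isRep v)

  label-orbits : CellsAreOrbits γ label
  label-orbits v w = mk⇔
    (Equivalence.to (same-rep⇔ v w) ∘ index-injective isRep (rep-isRep w) (rep-isRep v))
    (index-cong isRep (rep-isRep w) (rep-isRep v) ∘ Equivalence.from (same-rep⇔ v w))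

  label-surjective : ∀ i → ∃ λ v → label v ≡ i
  label-surjective i with index-surjective isRep i
  ... | v , h , e = v , trans (index-cong isRep (rep-isRep v) h (rep-of-rep v h)) e

  count-isRep : count isRep + count isRep ≡ n
  count-isRep = begin
    count isRep + count isRep
      ≡⟨ cong (count isRep +_) (count-permute isRep (permutation γ γ involutive involutive)) ⟨
    count isRep + count (isRep ∘ γ)
      ≡⟨ cong (count isRep +_) (count-ext isRep-γ) ⟩
    count isRep + count (not ∘ isRep)
      ≡⟨ count-complement isRep ⟩
    n ∎

involution⇒equitablePairPartition :
  ∀ {n} (G : Graph n) (γ : Permutation n n) → IsAutomorphism G γ →
  (∀ v → Inverse.to γ (Inverse.to γ v) ≡ v) → FixedPointFree γ → HasEquitablePairPartition G
involution⇒equitablePairPartition {n} G γ aut involutive fpf =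
  subst (λ m → Σ (Fin n → Fin m) λ c → AllCellsPairs c × IsEquitable G c)
        (m+m≡n⇒m≡n/2 count-isRep)
        (label , pairs , automorphism⇒equitable G aut)
  where
  open Representatives (Inverse.to γ) involutive fpf
  open OrbitCells (Inverse.to γ) label label-orbits fpf
  pairs : AllCellsPairs label
  pairs i with label-surjective i
  ... | v , refl = cellSize-orbit v

equitablePairPartition⇒involution :
  ∀ {n m} (G : Graph n) → n ≥ 1 → (c : Fin n → Fin m) → AllCellsPairs c → IsEquitable G c →
  Σ (Permutation n n) (λ γ → IsAutomorphism G γ × IsInvolution γ × FixedPointFree γ)
equitablePairPartition⇒involution G n≥1 c pairs equitable =
  γ-perm , equitable⇒automorphism G equitable ,
  (γ-involutive , λ identity → partner-moved (fromℕ< n≥1) (identity (fromℕ< n≥1))) ,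
  partner-moved
  where
  open Partner c pairs
  open OrbitCells partner c partner-orbits partner-moved

lemma5p1 : (n : ℕ) → n ≥ 1 → (G : Graph n) →
    (Σ (Permutation n n) (λ γ → IsAutomorphism G γ × IsInvolution γ × FixedPointFree γ))
      ⇔ HasEquitablePairPartition G
lemma5p1 n n≥1 G = mk⇔
  (λ (γ , aut , (involutive , _) , fpf) → involution⇒equitablePairPartition G γ aut involutive fpf)
  (λ (c , pairs , equitable) → equitablePairPartition⇒involution G n≥1 c pairs equitable)
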